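{- Let $n,k$ be integers with $3\leq k\leq n-1$ and let $G$ be a graph on $n$ vertices which is the $(1,2)$-step competition graph $C_{1,2}(T)$ of some $k$-hypertournament $T$ on $n$ vertices. Then the complement $G^{c}$ of $G$ does not contain a pair of disjoint edges (two edges with no common end-vertex).
   Context: Given integers $n\geq k>1$, a $k$-hypertournament on $n$ vertices is a pair $T=(V,A)$ where $|V|=n$ and $A$ is a set of $k$-tuples of distinct vertices (arcs) such that for every $k$-subset $S$ of $V$, $A$ contains exactly one of the $k!$ $k$-tuples whose entries are the elements of $S$. A path in $T$ is a sequence $v_1a_1v_2a_2\cdots a_{t-1}v_t$ of distinct vertices $v_1,\dots,v_t$ ($t\geq1$) and distinct arcs $a_1,\dots,a_{t-1}$ such that $v_i$ precedes $v_{i+1}$ in $a_i$; its length $l(\cdot)$ is the number of arcs, and it is an $(x,y)$-path if $v_1=x$, $v_t=y$. $C_{1,2}(T)$ is the graph on $V(T)$ in which $xy$ is an edge if and only if there exist a vertex $z\neq x,y$, an $(x,z)$-path $P$ and a $(y,z)$-path $Q$ such that: $y\notin V(P)$, $x\notin V(Q)$; either ($l(P)\leq 1$ and $l(Q)\leq 2$) or ($l(Q)\leq 1$ and $l(P)\leq 2$); and $P$, $Q$ are arc-disjoint. $G^c$ is the graph on $V(G)$ whose edges are the non-adjacent pairs of $G$. -}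

module Defs where

open import Data.Nat using (ℕ; zero; suc; _<_)
open import Data.Bool using (Bool; true)
open import Data.Fin using (Fin; zero; suc; inject₁; fromℕ; toℕ)
open import Data.Fin.Subset using (Subset; ∣_∣) renaming (_∈_ to _∈ₛ_)
open import Data.Vec using (Vec; lookup)
open import Data.Vec.Membership.Propositional using (_∈_)
open import Data.Product using (Σ; ∃; _×_; _,_)
open import Function.Bundles using (_⇔_)
open import Relation.Binary.PropositionalEquality using (_≡_; _≢_)
open import Relation.Nullary using (¬_)

Distinct : {A : Set} {m : ℕ} → Vec A m → Set
Distinct {m = m} t = (i j : Fin m) → lookup t i ≡ lookup t j → i ≡ j

EntriesOf : {n k : ℕ} → Vec (Fin n) k → Subset n → Set
EntriesOf {n} t S = (v : Fin n) → (v ∈ₛ S) ⇔ (v ∈ t)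

record Hypertournament (n k : ℕ) : Set where
  field
    arc : Vec (Fin n) k → Bool
    arc-distinct : (t : Vec (Fin n) k) → arc t ≡ true → Distinct t
    exactly-one : (S : Subset n) → ∣ S ∣ ≡ k →
      Σ (Vec (Fin n) k) λ t →
        (Distinct t × EntriesOf t S × arc t ≡ true) ×
        ((t' : Vec (Fin n) k) → Distinct t' → EntriesOf t' S → arc t' ≡ true → t' ≡ t)

module _ {n k : ℕ} (T : Hypertournament n k) where
  open Hypertournament T

  Precedes : Fin n → Fin n → Vec (Fin n) k → Set
  Precedes v w a = Σ (Fin k) λ i → Σ (Fin k) λ j →
    (toℕ i < toℕ j) × (lookup a i ≡ v) × (lookup a j ≡ w)

  record Path (x y : Fin n) : Set where
    field
      len   : ℕ
      verts : Vec (Fin n) (suc len)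
      arcs  : Vec (Vec (Fin n) k) len
      verts-distinct : Distinct verts
      arcs-distinct  : Distinct arcs
      arcs-in-T : (i : Fin len) → arc (lookup arcs i) ≡ true
      consecutive : (i : Fin len) →
        Precedes (lookup verts (inject₁ i)) (lookup verts (suc i)) (lookup arcs i)
      starts : lookup verts zero ≡ x
      ends   : lookup verts (fromℕ len) ≡ y

  open Path public

  OnPath : {x y : Fin n} → Fin n → Path x y → Set
  OnPath v P = v ∈ verts P

  ArcDisjoint : {x y x' y' : Fin n} → Path x y → Path x' y' → Set
  ArcDisjoint P Q = (i : Fin (len P)) (j : Fin (len Q)) →
    lookup (arcs P) i ≢ lookup (arcs Q) j

  C12 : Fin n → Fin n → Set
  C12 x y = Σ (Fin n) λ z → (z ≢ x) × (z ≢ y) ×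
    Σ (Path x z) λ P → Σ (Path y z) λ Q →
      (¬ OnPath y P) × (¬ OnPath x Q) ×
      (((len P ≤ℕ 1) × (len Q ≤ℕ 2)) ⊎' ((len Q ≤ℕ 1) × (len P ≤ℕ 2))) ×
      ArcDisjoint P Q
    where
    open import Data.Nat renaming (_≤_ to _≤ℕ_)
    open import Data.Sum renaming (_⊎_ to _⊎'_)

  C12ᶜ : Fin n → Fin n → Set
  C12ᶜ x y = (x ≢ y) × ¬ C12 x y

-- For each w ∈ {a, b, c}, since 3 ≤ k < n there is an arc A_w containing the other three of
-- a, b, c, d but not w; these arcs are pairwise distinct. Two vertices are adjacent in C₁,₂(T)
-- when they precede a common vertex in two distinct arcs, and also when u precedes x and v
-- precedes y in two distinct arcs while a third arc contains x and y: whichever of x, y comes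
-- first there extends one of the arcs to a path of length 2. Comparing a with c in A_b, and then
-- one pair in A_a and one in A_c, always exhibits one of these patterns for ab or for cd.

module Submission where

open import Defs
open import Data.Nat using (ℕ; _≤_; _<_; suc; _+_; _∸_; z≤n; s≤s)
open import Data.Nat.Properties
  using (≤-antisym; ≰⇒>; _≤?_; <⇒≢; <-cmp; +-suc; +-monoʳ-≤; m≤n⇒m≤1+n; ∸-monoˡ-≤;
         module ≤-Reasoning)
open import Data.Bool using (true)
open import Data.Fin using (Fin; zero; suc; toℕ)
open import Data.Fin.Properties using (toℕ-injective)
open import Data.Fin.Subset using (Subset; ∣_∣; ⁅_⁆; _∪_; ∁; inside; outside)
  renaming (_∈_ to _∈ₛ_; _⊆_ to _⊆ₛ_)
open import Data.Fin.Subset.Properties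
  using (s⊆s; out⊆; drop-∷-⊆; x∈⁅x⁆; x∈⁅y⁆⇒x≡y; x≢y⇒x∉⁅y⁆; ∣⁅x⁆∣≡1; ∣∁p∣≡n∸∣p∣;
         x∈∁p⇒x∉p; x∉p⇒x∈∁p; x∈p∪q⁻; x∈p∪q⁺)
open import Data.Vec using (Vec; []; _∷_; lookup; _[_]=_)
open import Data.Vec.Relation.Unary.Any using (index)
import Data.Vec.Relation.Unary.Any as Any
open import Data.Vec.Relation.Unary.Any.Properties using (¬Any[]; lookup-index)
open import Data.Vec.Membership.Propositional using (_∈_; _∉_)
open import Data.Vec.Membership.Propositional.Properties using (∈-lookup)
open import Data.Product using (Σ; _×_; _,_)
open import Data.Sum using (_⊎_; inj₁; inj₂; [_,_]′; swap)
open import Data.Empty using (⊥-elim)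
open import Function using (id)
open import Function.Bundles using (Equivalence)
open import Relation.Binary using (tri<; tri≈; tri>)
open import Relation.Binary.PropositionalEquality
  using (_≡_; _≢_; refl; sym; trans; subst; cong; cong₂; ≢-sym; module ≡-Reasoning)
open import Relation.Nullary using (¬_; yes; no)

module _ {A : Set} where

  ∉-∷ : {y x : A} {m : ℕ} {xs : Vec A m} → y ≢ x → y ∉ xs → y ∉ x ∷ xs
  ∉-∷ y≢x y∉xs (Any.here y≡x) = y≢x y≡x
  ∉-∷ y≢x y∉xs (Any.there y∈xs) = y∉xs y∈xs

  ∉∧∈⇒≢ : {w : A} {m : ℕ} {xs ys : Vec A m} → w ∉ xs → w ∈ ys → xs ≢ ys
  ∉∧∈⇒≢ w∉xs w∈ys refl = w∉xs w∈ys

  Distinct-[] : Distinct {A} []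
  Distinct-[] ()

  Distinct-∷ : {x : A} {m : ℕ} {xs : Vec A m} → x ∉ xs → Distinct xs → Distinct (x ∷ xs)
  Distinct-∷ x∉xs distinct zero zero _ = refl
  Distinct-∷ x∉xs distinct zero (suc j) x≡xⱼ = ⊥-elim (x∉xs (subst (_∈ _) (sym x≡xⱼ) (∈-lookup j _)))
  Distinct-∷ x∉xs distinct (suc i) zero xᵢ≡x = ⊥-elim (x∉xs (subst (_∈ _) xᵢ≡x (∈-lookup i _)))
  Distinct-∷ x∉xs distinct (suc i) (suc j) xᵢ≡xⱼ = cong suc (distinct i j xᵢ≡xⱼ)

  Distinct-[_] : (x : A) → Distinct (x ∷ [])
  Distinct-[ x ] = Distinct-∷ ¬Any[] Distinct-[]

∣p∪q∣≤∣p∣+∣q∣ : {m : ℕ} (p q : Subset m) → ∣ p ∪ q ∣ ≤ ∣ p ∣ + ∣ q ∣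
∣p∪q∣≤∣p∣+∣q∣ [] [] = z≤n
∣p∪q∣≤∣p∣+∣q∣ (outside ∷ p) (outside ∷ q) = ∣p∪q∣≤∣p∣+∣q∣ p q
∣p∪q∣≤∣p∣+∣q∣ (inside ∷ p) (outside ∷ q) = s≤s (∣p∪q∣≤∣p∣+∣q∣ p q)
∣p∪q∣≤∣p∣+∣q∣ (outside ∷ p) (inside ∷ q) =
  subst (suc ∣ p ∪ q ∣ ≤_) (sym (+-suc ∣ p ∣ ∣ q ∣)) (s≤s (∣p∪q∣≤∣p∣+∣q∣ p q))
∣p∪q∣≤∣p∣+∣q∣ (inside ∷ p) (inside ∷ q) =
  s≤s (subst (∣ p ∪ q ∣ ≤_) (sym (+-suc ∣ p ∣ ∣ q ∣)) (m≤n⇒m≤1+n (∣p∪q∣≤∣p∣+∣q∣ p q)))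

subset-between : {m j : ℕ} (X Y : Subset m) → X ⊆ₛ Y → ∣ X ∣ ≤ j → j ≤ ∣ Y ∣ →
  Σ (Subset m) λ S → X ⊆ₛ S × S ⊆ₛ Y × ∣ S ∣ ≡ j
subset-between [] [] _ z≤n z≤n = [] , id , id , refl
subset-between (inside ∷ X) (outside ∷ Y) X⊆Y _ _ with X⊆Y _[_]=_.here
... | ()
subset-between (outside ∷ X) (outside ∷ Y) X⊆Y ∣X∣≤j j≤∣Y∣
  with subset-between X Y (drop-∷-⊆ X⊆Y) ∣X∣≤j j≤∣Y∣
... | S , X⊆S , S⊆Y , ∣S∣≡j = outside ∷ S , s⊆s X⊆S , s⊆s S⊆Y , ∣S∣≡j
subset-between (inside ∷ X) (inside ∷ Y) X⊆Y (s≤s ∣X∣≤j) (s≤s j≤∣Y∣)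
  with subset-between X Y (drop-∷-⊆ X⊆Y) ∣X∣≤j j≤∣Y∣
... | S , X⊆S , S⊆Y , ∣S∣≡j = inside ∷ S , s⊆s X⊆S , s⊆s S⊆Y , cong suc ∣S∣≡j
subset-between {j = j} (outside ∷ X) (inside ∷ Y) X⊆Y ∣X∣≤j j≤1+∣Y∣ with j ≤? ∣ Y ∣
... | no j≰∣Y∣ = inside ∷ Y , X⊆Y , id , ≤-antisym (≰⇒> j≰∣Y∣) j≤1+∣Y∣
... | yes j≤∣Y∣ with subset-between X Y (drop-∷-⊆ X⊆Y) ∣X∣≤j j≤∣Y∣
...   | S , X⊆S , S⊆Y , ∣S∣≡j = outside ∷ S , s⊆s X⊆S , out⊆ S⊆Y , ∣S∣≡j

module _ {n k : ℕ} (T : Hypertournament n k) where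
  open Hypertournament T

  record Arc : Set where
    field
      tuple  : Vec (Fin n) k
      is-arc : arc tuple ≡ true

  open Arc

  record _⇝[_]_ (x : Fin n) (A : Arc) (y : Fin n) : Set where
    constructor precedes-in
    field precedes : Precedes T x y (tuple A)

  open _⇝[_]_

  ⇝-total : {x y : Fin n} (A : Arc) → x ∈ tuple A → y ∈ tuple A → x ≢ y → x ⇝[ A ] y ⊎ y ⇝[ A ] x
  ⇝-total A x∈A y∈A x≢y with <-cmp (toℕ (index x∈A)) (toℕ (index y∈A))
  ... | tri< i<j _ _ =
    inj₁ (precedes-in (index x∈A , index y∈A , i<j , sym (lookup-index x∈A) , sym (lookup-index y∈A)))
  ... | tri> _ _ j<i =
    inj₂ (precedes-in (index y∈A , index x∈A , j<i , sym (lookup-index y∈A) , sym (lookup-index x∈A)))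
  ... | tri≈ _ i≡j _ = ⊥-elim (x≢y (begin
    _                            ≡⟨ lookup-index x∈A ⟩
    lookup (tuple A) (index x∈A) ≡⟨ cong (lookup (tuple A)) (toℕ-injective i≡j) ⟩
    lookup (tuple A) (index y∈A) ≡⟨ sym (lookup-index y∈A) ⟩
    _                            ∎))
    where open ≡-Reasoning

  ⇝⇒≢ : {x y : Fin n} {A : Arc} → x ⇝[ A ] y → x ≢ y
  ⇝⇒≢ {A = A} (precedes-in (i , j , i<j , refl , refl)) xᵢ≡xⱼ =
    <⇒≢ i<j (cong toℕ (arc-distinct (tuple A) (is-arc A) i j xᵢ≡xⱼ))

  arc-path : {x z : Fin n} {A : Arc} → x ⇝[ A ] z → Path T x z
  arc-path {x} {z} {A} x⇝z = record
    { len = 1 ; verts = x ∷ z ∷ [] ; arcs = tuple A ∷ []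
    ; verts-distinct = Distinct-∷ (∉-∷ (⇝⇒≢ x⇝z) ¬Any[]) Distinct-[ z ]
    ; arcs-distinct = Distinct-[ tuple A ]
    ; arcs-in-T = λ { zero → is-arc A }
    ; consecutive = λ { zero → precedes x⇝z }
    ; starts = refl ; ends = refl }

  arc-path₂ : {x m z : Fin n} {A B : Arc} → x ≢ z → tuple A ≢ tuple B →
    x ⇝[ A ] m → m ⇝[ B ] z → Path T x z
  arc-path₂ {x} {m} {z} {A} {B} x≢z A≢B x⇝m m⇝z = record
    { len = 2 ; verts = x ∷ m ∷ z ∷ [] ; arcs = tuple A ∷ tuple B ∷ []
    ; verts-distinct =
        Distinct-∷ (∉-∷ (⇝⇒≢ x⇝m) (∉-∷ x≢z ¬Any[])) (Distinct-∷ (∉-∷ (⇝⇒≢ m⇝z) ¬Any[]) Distinct-[ z ])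
    ; arcs-distinct = Distinct-∷ (∉-∷ A≢B ¬Any[]) Distinct-[ tuple B ]
    ; arcs-in-T = λ { zero → is-arc A ; (suc zero) → is-arc B }
    ; consecutive = λ { zero → precedes x⇝m ; (suc zero) → precedes m⇝z }
    ; starts = refl ; ends = refl }

  C12-sym : {x y : Fin n} → C12 T x y → C12 T y x
  C12-sym (z , z≢x , z≢y , P , Q , y∉P , x∉Q , lengths , P∥Q) =
    z , z≢y , z≢x , Q , P , x∉Q , y∉P , swap lengths , λ i j → ≢-sym (P∥Q j i)

  C12-common-successor : {x y z : Fin n} {A B : Arc} → x ≢ y → tuple A ≢ tuple B →
    x ⇝[ A ] z → y ⇝[ B ] z → C12 T x y
  C12-common-successor x≢y A≢B x⇝z y⇝z =
    _ , ≢-sym (⇝⇒≢ x⇝z) , ≢-sym (⇝⇒≢ y⇝z) , arc-path x⇝z , arc-path y⇝z ,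
    ∉-∷ (≢-sym x≢y) (∉-∷ (⇝⇒≢ y⇝z) ¬Any[]) , ∉-∷ x≢y (∉-∷ (⇝⇒≢ x⇝z) ¬Any[]) ,
    inj₁ (s≤s z≤n , s≤s z≤n) ,
    λ { zero zero → A≢B }

  C12-detour : {x y m z : Fin n} {A B C : Arc} → x ≢ y → x ≢ m → y ≢ z →
    tuple A ≢ tuple B → tuple A ≢ tuple C → tuple B ≢ tuple C →
    x ⇝[ A ] z → y ⇝[ B ] m → m ⇝[ C ] z → C12 T x y
  C12-detour x≢y x≢m y≢z A≢B A≢C B≢C x⇝z y⇝m m⇝z =
    _ , ≢-sym (⇝⇒≢ x⇝z) , ≢-sym y≢z , arc-path x⇝z , arc-path₂ y≢z B≢C y⇝m m⇝z ,
    ∉-∷ (≢-sym x≢y) (∉-∷ y≢z ¬Any[]) , ∉-∷ x≢y (∉-∷ x≢m (∉-∷ (⇝⇒≢ x⇝z) ¬Any[])) ,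
    inj₁ (s≤s z≤n , s≤s (s≤s z≤n)) ,
    λ { zero zero → A≢B ; zero (suc zero) → A≢C }

  C12-linked-successors : {u v x y : Fin n} {A B : Arc} (C : Arc) → u ≢ v → u ≢ y → v ≢ x → x ≢ y →
    x ∈ tuple C → y ∈ tuple C → tuple A ≢ tuple B → tuple A ≢ tuple C → tuple B ≢ tuple C →
    u ⇝[ A ] x → v ⇝[ B ] y → C12 T u v
  C12-linked-successors C u≢v u≢y v≢x x≢y x∈C y∈C A≢B A≢C B≢C u⇝x v⇝y
    with ⇝-total C x∈C y∈C x≢y
  ... | inj₁ x⇝y = C12-sym (C12-detour (≢-sym u≢v) v≢x u≢y (≢-sym A≢B) B≢C A≢C v⇝y u⇝x x⇝y)
  ... | inj₂ y⇝x = C12-detour u≢v u≢y v≢x A≢B A≢C B≢C u⇝x v⇝y y⇝x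

  arc-between : (X Y : Subset n) → X ⊆ₛ Y → ∣ X ∣ ≤ k → k ≤ ∣ Y ∣ →
    Σ Arc λ A → (∀ {v} → v ∈ₛ X → v ∈ tuple A) × (∀ {v} → v ∈ tuple A → v ∈ₛ Y)
  arc-between X Y X⊆Y ∣X∣≤k k≤∣Y∣ with subset-between X Y X⊆Y ∣X∣≤k k≤∣Y∣
  ... | S , X⊆S , S⊆Y , ∣S∣≡k with exactly-one S ∣S∣≡k
  ...   | t , (_ , t~S , t∈T) , _ =
    record { tuple = t ; is-arc = t∈T } ,
    (λ v∈X → Equivalence.to (t~S _) (X⊆S v∈X)) ,
    (λ v∈t → S⊆Y (Equivalence.from (t~S _) v∈t))

  ArcAvoiding : (w x y z : Fin n) → Set
  ArcAvoiding w x y z = Σ Arc λ A → x ∈ tuple A × y ∈ tuple A × z ∈ tuple A × w ∉ tuple A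

  arc-avoiding : 3 ≤ k → k < n → {w x y z : Fin n} → x ≢ w → y ≢ w → z ≢ w → ArcAvoiding w x y z
  arc-avoiding 3≤k k<n {w} {x} {y} {z} x≢w y≢w z≢w
    with arc-between X (∁ ⁅ w ⁆) X⊆∁w ∣X∣≤k k≤∣∁w∣
    where
    X = ⁅ x ⁆ ∪ (⁅ y ⁆ ∪ ⁅ z ⁆)

    X⊆∁w : X ⊆ₛ ∁ ⁅ w ⁆
    X⊆∁w {v} v∈X = x∉p⇒x∈∁p (x≢y⇒x∉⁅y⁆ v≢w)
      where
      v≢w : v ≢ w
      v≢w with x∈p∪q⁻ ⁅ x ⁆ _ v∈X
      ... | inj₁ v∈x = subst (_≢ w) (sym (x∈⁅y⁆⇒x≡y x v∈x)) x≢w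
      ... | inj₂ v∈yz with x∈p∪q⁻ ⁅ y ⁆ _ v∈yz
      ...   | inj₁ v∈y = subst (_≢ w) (sym (x∈⁅y⁆⇒x≡y y v∈y)) y≢w
      ...   | inj₂ v∈z = subst (_≢ w) (sym (x∈⁅y⁆⇒x≡y z v∈z)) z≢w

    ∣X∣≤k : ∣ X ∣ ≤ k
    ∣X∣≤k = begin
      ∣ X ∣                                ≤⟨ ∣p∪q∣≤∣p∣+∣q∣ ⁅ x ⁆ _ ⟩
      ∣ ⁅ x ⁆ ∣ + ∣ ⁅ y ⁆ ∪ ⁅ z ⁆ ∣        ≤⟨ +-monoʳ-≤ ∣ ⁅ x ⁆ ∣ (∣p∪q∣≤∣p∣+∣q∣ ⁅ y ⁆ ⁅ z ⁆) ⟩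
      ∣ ⁅ x ⁆ ∣ + (∣ ⁅ y ⁆ ∣ + ∣ ⁅ z ⁆ ∣)  ≡⟨ cong₂ _+_ (∣⁅x⁆∣≡1 x) (cong₂ _+_ (∣⁅x⁆∣≡1 y) (∣⁅x⁆∣≡1 z)) ⟩
      3                                    ≤⟨ 3≤k ⟩
      k                                    ∎
      where open ≤-Reasoning

    k≤∣∁w∣ : k ≤ ∣ ∁ ⁅ w ⁆ ∣
    k≤∣∁w∣ = subst (k ≤_) (sym (trans (∣∁p∣≡n∸∣p∣ ⁅ w ⁆) (cong (n ∸_) (∣⁅x⁆∣≡1 w)))) (∸-monoˡ-≤ 1 k<n)
  ... | A , X⊆A , A⊆∁w =
    A ,
    X⊆A (x∈p∪q⁺ (inj₁ (x∈⁅x⁆ x))) ,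
    X⊆A (x∈p∪q⁺ (inj₂ (x∈p∪q⁺ (inj₁ (x∈⁅x⁆ y))))) ,
    X⊆A (x∈p∪q⁺ (inj₂ (x∈p∪q⁺ (inj₂ (x∈⁅x⁆ z))))) ,
    λ w∈A → x∈∁p⇒x∉p (A⊆∁w w∈A) (x∈⁅x⁆ w)

  one-of-two-pairs-adjacent : {a b c d : Fin n} →
    a ≢ b → c ≢ d → a ≢ c → a ≢ d → b ≢ c → b ≢ d →
    ArcAvoiding a b c d → ArcAvoiding b a c d → ArcAvoiding c a b d →
    C12 T a b ⊎ C12 T c d
  one-of-two-pairs-adjacent {a} {b} {c} {d} a≢b c≢d a≢c a≢d b≢c b≢d
    (Aa , b∈Aa , c∈Aa , d∈Aa , a∉Aa) (Ab , a∈Ab , c∈Ab , _ , b∉Ab) (Ac , a∈Ac , b∈Ac , d∈Ac , _) =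
    compare-a-c-in-Ab
    where
    Aa≢Ab : tuple Aa ≢ tuple Ab
    Aa≢Ab = ∉∧∈⇒≢ a∉Aa a∈Ab
    Aa≢Ac : tuple Aa ≢ tuple Ac
    Aa≢Ac = ∉∧∈⇒≢ a∉Aa a∈Ac
    Ab≢Ac : tuple Ab ≢ tuple Ac
    Ab≢Ac = ∉∧∈⇒≢ b∉Ab b∈Ac

    compare-a-c-in-Ab : C12 T a b ⊎ C12 T c d
    compare-a-c-in-Ab with ⇝-total Ab a∈Ab c∈Ab a≢c
    ... | inj₁ a⇝c with ⇝-total Aa b∈Aa c∈Aa b≢c
    ...   | inj₁ b⇝c = inj₁ (C12-common-successor a≢b (≢-sym Aa≢Ab) a⇝c b⇝c)
    ...   | inj₂ c⇝b with ⇝-total Ac b∈Ac d∈Ac b≢d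
    ...     | inj₁ b⇝d = inj₁ (C12-linked-successors Aa a≢b a≢d b≢c c≢d c∈Aa d∈Aa
                                  Ab≢Ac (≢-sym Aa≢Ab) (≢-sym Aa≢Ac) a⇝c b⇝d)
    ...     | inj₂ d⇝b = inj₂ (C12-common-successor c≢d Aa≢Ac c⇝b d⇝b)
    compare-a-c-in-Ab | inj₂ c⇝a with ⇝-total Ac a∈Ac d∈Ac a≢d
    ...   | inj₂ d⇝a = inj₂ (C12-common-successor c≢d Ab≢Ac c⇝a d⇝a)
    ...   | inj₁ a⇝d with ⇝-total Aa b∈Aa d∈Aa b≢d
    ...     | inj₁ b⇝d = inj₁ (C12-common-successor a≢b (≢-sym Aa≢Ac) a⇝d b⇝d)
    ...     | inj₂ d⇝b = inj₂ (C12-linked-successors Ac c≢d (≢-sym b≢c) (≢-sym a≢d) a≢b a∈Ac b∈Ac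
                                  (≢-sym Aa≢Ab) Ab≢Ac Aa≢Ac c⇝a d⇝b)

lemma3p1 : (n k : ℕ) → 3 ≤ k → suc k ≤ n → (T : Hypertournament n k) →
    ¬ (Σ (Fin n) λ a → Σ (Fin n) λ b → Σ (Fin n) λ c → Σ (Fin n) λ d →
    C12ᶜ T a b × C12ᶜ T c d ×
    (a ≢ c) × (a ≢ d) × (b ≢ c) × (b ≢ d))
lemma3p1 n k 3≤k k<n T (a , b , c , d , (a≢b , ¬ab) , (c≢d , ¬cd) , a≢c , a≢d , b≢c , b≢d) =
  [ ¬ab , ¬cd ]′ (one-of-two-pairs-adjacent T a≢b c≢d a≢c a≢d b≢c b≢d
    (arc-avoiding T 3≤k k<n (≢-sym a≢b) (≢-sym a≢c) (≢-sym a≢d))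
    (arc-avoiding T 3≤k k<n a≢b (≢-sym b≢c) (≢-sym b≢d))
    (arc-avoiding T 3≤k k<n a≢c b≢c (≢-sym c≢d)))
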